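{- Let $O$ be a set of ordinals and let $\mathrm{T}_O=\{\langle\lambda,0^\lambda\rangle:\lambda\in O\}$ if $0\in O$, and $\mathrm{T}_O=\varnothing$ otherwise, where $0^\lambda$ denotes the constant sequence of length $\lambda$ all of whose entries are $0$. Then $\mathrm{T}_O$ is a terminal object of $\mathbf{SMonogr}_O$.
   Context: A monograph is a set $A$ of ordered pairs which is a functional relation with domain some set $E$ (the edges of $A$, written $\mathrm{E}_A$) such that each $A(x)$, $x\in E$, is a function $\lambda\to E$ for some ordinal $\lambda=|x|$ (the length of $x$); $x_\iota$ denotes $A(x)(\iota)$. A node is an edge of length $0$; $A$ is standard if every edge occurring in some $A(x)$ is a node; for a set $O$ of ordinals $A$ is an $O$-monograph if all edge lengths lie in $O$. A morphism $f:A\to B$ is a function $f:\mathrm{E}_A\to\mathrm{E}_B$ with $|f(x)|=|x|$ and $f(x_\iota)=f(x)_\iota$ for all $x,\iota<|x|$. $\mathbf{SMonogr}_O$ is the category of standard $O$-monographs and their morphisms. (Note that $\mathrm{T}_O$ is a standard $O$-monograph whose set of edges is $O$ when $0\in O$.) -}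

module Defs where

open import Level using (Level; 0ℓ)
open import Data.Product using (Σ; _×_; _,_; proj₁)
open import Data.Empty using (⊥)
open import Relation.Nullary using (¬_)
open import Relation.Binary.PropositionalEquality using (_≡_; subst; sym)
open import Relation.Binary.Definitions using (Trichotomous; Transitive)
open import Induction.WellFounded using (WellFounded)

-- A (set-sized) universe of ordinals: a type with a strict well-order
-- whose least element is 0.  The ordinal λ is identified with the set
-- { κ : κ < λ } of smaller ordinals (von Neumann convention).
record Ordinals : Set₁ where
  field
    Ord       : Set
    _<_       : Ord → Ord → Set
    <-prop    : ∀ {κ l} (p q : κ < l) → p ≡ q
    <-trans   : Transitive _<_
    <-tri     : Trichotomous _≡_ _<_
    <-wf      : WellFounded _<_
    zero      : Ord
    zero-least : ∀ κ → ¬ (κ < zero)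

module _ (Ω : Ordinals) where
  open Ordinals Ω

  record OrdSet : Set₁ where
    field
      _∈O    : Ord → Set
      ∈-prop : ∀ {l} (p q : _∈O l) → p ≡ q
  open OrdSet public

  record Monograph : Set₁ where
    field
      E    : Set
      len  : E → Ord
      edge : (x : E) → (κ : Ord) → κ < len x → E
  open Monograph public

  -- Nodes are edges of length 0; standard = every edge occurring in a
  -- sequence is a node.
  IsStandard : Monograph → Set
  IsStandard A = ∀ x κ (p : κ < len A x) → len A (edge A x κ p) ≡ zero

  IsOMonograph : OrdSet → Monograph → Set
  IsOMonograph O A = ∀ x → (O ∈O) (len A x)

  IsStandardO : OrdSet → Monograph → Set
  IsStandardO O A = IsStandard A × IsOMonograph O A

  record Morphism (A B : Monograph) : Set where
    field
      fun     : E A → E B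
      len-pres : ∀ x → len B (fun x) ≡ len A x
      comm    : ∀ x κ (p : κ < len A x) →
                fun (edge A x κ p) ≡ edge B (fun x) κ (subst (κ <_) (sym (len-pres x)) p)
  open Morphism public

  -- T_O = { ⟨λ, 0^λ⟩ : λ ∈ O } if 0 ∈ O, and ∅ otherwise; uniformly,
  -- the edges are the λ ∈ O subject to the side condition 0 ∈ O.
  T : OrdSet → Monograph
  T O = record
    { E    = Σ Ord (λ l → (O ∈O) l × (O ∈O) zero)
    ; len  = proj₁
    ; edge = λ { (l , p , z) κ _ → (zero , z , z) }
    }

  -- Terminal object of SMonogr_O: an object of the category such that
  -- from every object there is exactly one morphism into it
  -- (uniqueness of morphisms = equality as functions on edges, pointwise).
  IsTerminalSMonogr : OrdSet → Monograph → Set₁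
  IsTerminalSMonogr O Z =
    IsStandardO O Z ×
    (∀ (A : Monograph) → IsStandardO O A →
       Σ (Morphism A Z) (λ f → ∀ (g : Morphism A Z) → ∀ x → fun g x ≡ fun f x))

{-# OPTIONS --safe #-}
module Submission where

-- An edge of T_O is determined by its length, since membership in O is
-- proof-irrelevant; so the only candidate morphism A → T_O sends x to |x|,
-- and it is a morphism because A is standard: x_κ is a node and 0_κ = 0.
-- For it to exist, a nonempty A must force 0 ∈ O: some edge of A is a node,
-- namely x itself if |x| = 0 and x_0 otherwise.

open import Defs
open import Data.Product using (_,_; proj₁; proj₂)
open import Data.Empty using (⊥-elim)
open import Relation.Binary.PropositionalEquality using (_≡_; refl; subst; sym)
open import Relation.Binary.Definitions using (tri<; tri≈; tri>)

module _ (Ω : Ordinals) (O : OrdSet Ω) where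
  open Ordinals Ω

  T-edge-≡ : ∀ {l l'} {a : (O ∈O) l} {a' : (O ∈O) l'} {z z' : (O ∈O) zero} →
             l ≡ l' → _≡_ {A = E (T Ω O)} (l , a , z) (l' , a' , z')
  T-edge-≡ {a = a} {a'} {z} {z'} refl
    rewrite ∈-prop O a a' | ∈-prop O z z' = refl

  T-isStandardO : IsStandardO Ω O (T Ω O)
  T-isStandardO = (λ _ _ _ → refl) , (λ { (_ , l∈O , _) → l∈O })

  zero∈O-of-edge : (A : Monograph Ω) → IsStandardO Ω O A → E A → (O ∈O) zero
  zero∈O-of-edge A (standard , lens∈O) x with <-tri zero (len A x)
  ... | tri< 0<|x| _ _ = subst (O ∈O) (standard x zero 0<|x|) (lens∈O (edge A x zero 0<|x|))
  ... | tri≈ _ 0≡|x| _ = subst (O ∈O) (sym 0≡|x|) (lens∈O x)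
  ... | tri> _ _ |x|<0 = ⊥-elim (zero-least _ |x|<0)

  to-T : (A : Monograph Ω) → IsStandardO Ω O A → Morphism Ω A (T Ω O)
  to-T A sA = record
    { fun      = λ x → len A x , proj₂ sA x , zero∈O-of-edge A sA x
    ; len-pres = λ _ → refl
    ; comm     = λ x κ p → T-edge-≡ (proj₁ sA x κ p)
    }

  to-T-unique : (A : Monograph Ω) (sA : IsStandardO Ω O A) (g : Morphism Ω A (T Ω O)) →
                ∀ x → fun g x ≡ fun (to-T A sA) x
  to-T-unique A sA g x = T-edge-≡ (len-pres g x)

lemma5 : (Ω : Ordinals) (O : OrdSet Ω) → IsTerminalSMonogr Ω O (T Ω O)
lemma5 Ω O = T-isStandardO Ω O , λ A sA → to-T Ω O A sA , to-T-unique Ω O A sA
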